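{- Let $k\ge3$ and $x=p_{2k-2}-1$, where $p_m$ is the $m$-th prime ($p_1=2$). For every integer $r$ with $|r-x/2|\le k-2$ there is a coloring of $\{1,\ldots,x\}$ with colors $0$ and $1$ having exactly $r$ vertices of color $0$ such that neither color class contains $k$ pairwise coprime integers.
   Context: A set of pairwise coprime integers means a set of distinct positive integers any two of which have greatest common divisor $1$. -}

module Defs where

open import Data.Nat using (ℕ; zero; suc; _<_; _≤_; _∸_)
open import Data.Nat.Primality using (Prime; prime?)
open import Data.Nat.Coprimality using (Coprime)
open import Data.Bool using (Bool)
open import Data.List using (List; length; filter; upTo; map)
open import Data.List.Relation.Unary.All using (All)
open import Data.List.Relation.Unary.AllPairs using (AllPairs)
open import Data.Product using (_×_)
open import Relation.Binary.PropositionalEquality using (_≡_; _≢_)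
open import Relation.Nullary.Decidable using (does)

primesBelow : ℕ → ℕ
primesBelow n = length (filter prime? (upTo n))

-- p is the m-th prime (1-indexed: p_1 = 2)
IsNthPrime : ℕ → ℕ → Set
IsNthPrime m p = Prime p × suc (primesBelow p) ≡ m

interval : ℕ → List ℕ
interval x = map suc (upTo x)

-- number of i ∈ {1,…,x} with colour false (= colour 0)
countColour0 : (ℕ → Bool) → ℕ → ℕ
countColour0 c x = length (filter (λ i → Data.Bool._≟_ (c i) Bool.false) (interval x))
  where import Data.Bool

MonoCoprimeSet : (ℕ → Bool) → ℕ → ℕ → Bool → Set
MonoCoprimeSet c x k b =
  Data.Product.Σ (List ℕ) λ S →
    length S ≡ k
    × AllPairs _≢_ S
    × AllPairs Coprime S
    × All (λ i → 1 ≤ i × i ≤ x) S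
    × All (λ i → c i ≡ b) S
  where import Data.Product

module Submission where

-- Write k = j + 3 and p - 1 = 2m, and pick T with exactly j + 2 primes below T; since p is the
-- (2j + 4)-th prime, j + 1 primes lie in [T, 2m].  Colour 1 consists of 1 and the multiples of
-- the odd primes below T, except that the even numbers up to a threshold t are given colour 0.
-- Every number of colour 1 is divisible by a "tag" in {1} ∪ {odd primes below T}, every number
-- of colour 0 by a tag in {2} ∪ {primes in [T, 2m]}; each tag set has j + 2 < k elements, and
-- distinct coprime numbers never share a tag, so no colour class holds k pairwise coprime
-- numbers.  As t runs from 0 to 2m the number of vertices of colour 0 changes by at most one
-- per step, from at most m (1 and the multiples of the odd primes below T already fill half of
-- [1, 2m]; once T > 7 the multiples of 3, 5 and 7 suffice) to at least m + j + 1 (the even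
-- numbers and the primes in [T, 2m]), so it takes every value in [m, m + j + 1]; swapping the
-- two colours gives the values in [m - j - 1, m].

open import Defs

open import Data.Bool using (Bool; true; false; not; if_then_else_)
import Data.Bool as Bool
open import Data.Bool.Properties using (not-involutive)
open import Data.Empty using (⊥; ⊥-elim)
open import Data.List using (List; []; _∷_; length; filter; applyUpTo; _++_; [_]; map; upTo)
open import Data.List.Properties using (applyUpTo-∷ʳ; filter-++; length-++; map-upTo)
open import Data.List.Relation.Unary.All as All using (All; []; _∷_; all?)
open import Data.List.Relation.Unary.AllPairs using (AllPairs; []; _∷_)
open import Data.List.Relation.Unary.Any using (Any; here; there; any?)
open import Data.Nat.Base using (ℕ; zero; suc; _+_; _*_; _∸_; _≤_; _<_; z≤n; s≤s; s≤s⁻¹; z<s; >-nonZero)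
open import Data.Nat.Properties
open import Algebra.Properties.CommutativeSemigroup +-commutativeSemigroup
  using (interchange; xy∙z≈xz∙y; x∙yz≈xz∙y; xy∙z≈x∙zy)
open import Data.Nat.Coprimality using (Coprime)
open import Data.Nat.Divisibility using (_∣_; _∣?_; divides; m∣m*n; ∣-refl; ∣⇒≤; ∣1⇒≡1; ∣m∣n⇒∣m+n; ∣m+n∣m⇒∣n)
open import Data.Nat.DivMod using (_/_; m≡m%n+[m/n]*n; m%n<n)
open import Data.Nat.ListAction using (product)
open import Data.Nat.Primality using (Prime; prime?; ¬prime[0]; ¬prime[1]; prime[2]; prime⇒irreducible)
open import Data.Nat.Primality.Factorisation using (factorise)
open import Data.Product using (Σ; ∃-syntax; _×_; _,_; proj₁; proj₂)
open import Data.Sum using (_⊎_; inj₁; inj₂)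
open import Function using (_∘_; id; case_of_; _⇔_; mk⇔; Equivalence)
open import Level using (Level; 0ℓ)
open import Relation.Binary.PropositionalEquality hiding ([_])
open import Relation.Nullary using (Dec; yes; no; ¬_; ¬?; does; contradiction)
open import Relation.Nullary.Decidable using (does-⇔; _⊎-dec_; _×-dec_; from-yes; toSum)
open import Relation.Unary using (Pred; Decidable; _∪_; _∩_; ∁)
open import Relation.Unary.Properties using (_∪?_; _∩?_; ∁?)

private variable
  a p q : Level
  A B : Set a
  P : Pred ℕ p
  Q : Pred ℕ q

indicator : Dec A → ℕ
indicator A? = if does A? then 1 else 0

indicator-yes : (A? : Dec A) → A → indicator A? ≡ 1
indicator-yes (yes _) _ = refl
indicator-yes (no ¬a) a = contradiction a ¬a

indicator-no : (A? : Dec A) → ¬ A → indicator A? ≡ 0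
indicator-no (yes a) ¬a = contradiction a ¬a
indicator-no (no _)  _  = refl

indicator-⇔ : A ⇔ B → (A? : Dec A) (B? : Dec B) → indicator A? ≡ indicator B?
indicator-⇔ A⇔B A? B? = cong (λ b → if b then 1 else 0) (does-⇔ A⇔B A? B?)

indicator≤1 : (A? : Dec A) → indicator A? ≤ 1
indicator≤1 (yes _) = s≤s z≤n
indicator≤1 (no _)  = z≤n

does≡true⇒ : (A? : Dec A) → does A? ≡ true → A
does≡true⇒ (yes a) _ = a

does≡false⇒¬ : (A? : Dec A) → does A? ≡ false → ¬ A
does≡false⇒¬ (no ¬a) _ = ¬a

count : Decidable P → ℕ → ℕ
count P? zero    = 0
count P? (suc n) = count P? n + indicator (P? n)

module _ (P? : Decidable P) where

  count≤ : ∀ n → count P? n ≤ n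
  count≤ zero    = z≤n
  count≤ (suc n) = ≤-trans (+-mono-≤ (count≤ n) (indicator≤1 (P? n))) (≤-reflexive (+-comm n 1))

  count-suc≤ : ∀ n → count P? (suc n) ≤ suc (count P? n)
  count-suc≤ n = ≤-trans (+-monoʳ-≤ (count P? n) (indicator≤1 (P? n))) (≤-reflexive (+-comm _ 1))

  count-monoʳ : ∀ {m n} → m ≤ n → count P? m ≤ count P? n
  count-monoʳ {n = zero}  z≤n = z≤n
  count-monoʳ {n = suc n} m≤1+n with m≤n⇒m<n∨m≡n m≤1+n
  ... | inj₁ m<1+n = ≤-trans (count-monoʳ (s≤s⁻¹ m<1+n)) (m≤m+n _ _)
  ... | inj₂ refl  = ≤-refl

  count-cancelʳ-< : ∀ {m n} → count P? m < count P? n → m < n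
  count-cancelʳ-< {m} {n} lt with m <? n
  ... | yes m<n = m<n
  ... | no m≮n  = contradiction (count-monoʳ (≮⇒≥ m≮n)) (<⇒≱ lt)

  count-none : ∀ {n} → (∀ {i} → i < n → ¬ P i) → count P? n ≡ 0
  count-none {zero}  _  = refl
  count-none {suc n} ¬P = cong₂ _+_ (count-none (¬P ∘ m<n⇒m<1+n)) (indicator-no (P? n) (¬P ≤-refl))

  count-all : ∀ {n} → (∀ {i} → i < n → P i) → count P? n ≡ n
  count-all {zero}  _  = refl
  count-all {suc n} Ps = trans (cong₂ _+_ (count-all (Ps ∘ m<n⇒m<1+n)) (indicator-yes (P? n) (Ps ≤-refl))) (+-comm n 1)

  count-∘suc : ¬ P 0 → ∀ n → count (P? ∘ suc) n ≡ count P? (suc n)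
  count-∘suc ¬P0 zero    = sym (indicator-no (P? 0) ¬P0)
  count-∘suc ¬P0 (suc n) = cong (_+ indicator (P? (suc n))) (count-∘suc ¬P0 n)

  count-periodic : ∀ d → (∀ i → P (i + d) ⇔ P i) → ∀ n → count P? (n + d) ≡ count P? n + count P? d
  count-periodic d periodic zero    = refl
  count-periodic d periodic (suc n) = begin
    count P? (n + d) + indicator (P? (n + d))   ≡⟨ cong₂ _+_ (count-periodic d periodic n) (indicator-⇔ (periodic n) (P? (n + d)) (P? n)) ⟩
    count P? n + count P? d + indicator (P? n)  ≡⟨ xy∙z≈xz∙y (count P? n) _ _ ⟩
    count P? n + indicator (P? n) + count P? d  ∎
    where open ≡-Reasoning

  length-filter-applyUpTo : ∀ (f : ℕ → ℕ) n → length (filter P? (applyUpTo f n)) ≡ count (P? ∘ f) n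
  length-filter-applyUpTo f zero    = refl
  length-filter-applyUpTo f (suc n) = begin
    length (filter P? (applyUpTo f (suc n)))                         ≡⟨ cong (length ∘ filter P?) (applyUpTo-∷ʳ f n) ⟨
    length (filter P? (applyUpTo f n ++ [ f n ]))                    ≡⟨ cong length (filter-++ P? (applyUpTo f n) [ f n ]) ⟩
    length (filter P? (applyUpTo f n) ++ filter P? [ f n ])          ≡⟨ length-++ (filter P? (applyUpTo f n)) ⟩
    length (filter P? (applyUpTo f n)) + length (filter P? [ f n ])  ≡⟨ cong₂ _+_ (length-filter-applyUpTo f n) (length-filter-[ f n ]) ⟩
    count (P? ∘ f) n + indicator (P? (f n))                          ∎
    where
    open ≡-Reasoning
    length-filter-[_] : ∀ y → length (filter P? [ y ]) ≡ indicator (P? y)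
    length-filter-[ y ] with P? y
    ... | yes _ = refl
    ... | no _  = refl

module _ (P? : Decidable P) (Q? : Decidable Q) where

  count-mono : ∀ n → (∀ {i} → i < n → P i → Q i) → count P? n ≤ count Q? n
  count-mono zero    _   = z≤n
  count-mono (suc n) P⊆Q = +-mono-≤ (count-mono n (P⊆Q ∘ m<n⇒m<1+n)) (pointwise (P? n) (Q? n))
    where
    pointwise : (Pn? : Dec (P n)) (Qn? : Dec (Q n)) → indicator Pn? ≤ indicator Qn?
    pointwise (yes Pn) (no ¬Qn) = contradiction (P⊆Q ≤-refl Pn) ¬Qn
    pointwise (yes _)  (yes _)  = ≤-refl
    pointwise (no _)   _        = z≤n

  count-cong : ∀ n → (∀ {i} → i < n → P i ⇔ Q i) → count P? n ≡ count Q? n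
  count-cong zero    _   = refl
  count-cong (suc n) P⇔Q = cong₂ _+_ (count-cong n (P⇔Q ∘ m<n⇒m<1+n)) (indicator-⇔ (P⇔Q ≤-refl) (P? n) (Q? n))

  count-∪-∩ : ∀ n → count (P? ∪? Q?) n + count (P? ∩? Q?) n ≡ count P? n + count Q? n
  count-∪-∩ zero    = refl
  count-∪-∩ (suc n) = begin
    (count (P? ∪? Q?) n + indicator (P? n ⊎-dec Q? n)) + (count (P? ∩? Q?) n + indicator (P? n ×-dec Q? n))
      ≡⟨ interchange (count (P? ∪? Q?) n) _ _ _ ⟩
    (count (P? ∪? Q?) n + count (P? ∩? Q?) n) + (indicator (P? n ⊎-dec Q? n) + indicator (P? n ×-dec Q? n))
      ≡⟨ cong₂ _+_ (count-∪-∩ n) (pointwise (P? n) (Q? n)) ⟩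
    (count P? n + count Q? n) + (indicator (P? n) + indicator (Q? n))
      ≡⟨ interchange (count P? n) _ _ _ ⟩
    (count P? n + indicator (P? n)) + (count Q? n + indicator (Q? n)) ∎
    where
    open ≡-Reasoning
    pointwise : (Pn? : Dec (P n)) (Qn? : Dec (Q n)) →
      indicator (Pn? ⊎-dec Qn?) + indicator (Pn? ×-dec Qn?) ≡ indicator Pn? + indicator Qn?
    pointwise (yes _) (yes _) = refl
    pointwise (yes _) (no _)  = refl
    pointwise (no _)  (yes _) = refl
    pointwise (no _)  (no _)  = refl

  count-disjoint : ∀ n → (∀ {i} → i < n → P i → Q i → ⊥) → count (P? ∪? Q?) n ≡ count P? n + count Q? n
  count-disjoint n disjoint = begin
    count (P? ∪? Q?) n                       ≡⟨ +-identityʳ _ ⟨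
    count (P? ∪? Q?) n + 0                   ≡⟨ cong (count (P? ∪? Q?) n +_) (count-none (P? ∩? Q?) never-both) ⟨
    count (P? ∪? Q?) n + count (P? ∩? Q?) n  ≡⟨ count-∪-∩ n ⟩
    count P? n + count Q? n                  ∎
    where
    open ≡-Reasoning
    never-both : ∀ {i} → i < n → ¬ (P i × Q i)
    never-both i<n (Pi , Qi) = disjoint i<n Pi Qi

  count-∪≤ : ∀ n → count (P? ∪? Q?) n ≤ count P? n + count Q? n
  count-∪≤ n = ≤-trans (m≤m+n _ _) (≤-reflexive (count-∪-∩ n))

count-∁ : (P? : Decidable P) → ∀ n → count P? n + count (∁? P?) n ≡ n
count-∁ P? n = begin
  count P? n + count (∁? P?) n  ≡⟨ count-disjoint P? (∁? P?) n (λ _ Pi ¬Pi → ¬Pi Pi) ⟨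
  count (P? ∪? ∁? P?) n         ≡⟨ count-all (P? ∪? ∁? P?) (λ {i} _ → toSum (P? i)) ⟩
  n                             ∎
  where open ≡-Reasoning

count-≥ : (P? : Decidable P) → ∀ {a n} → a ≤ n → count (P? ∩? (a ≤?_)) n + count P? a ≡ count P? n
count-≥ P? {n = zero}  z≤n = refl
count-≥ P? {a} {suc n} a≤1+n with m≤n⇒m<n∨m≡n a≤1+n
... | inj₂ refl  = cong (_+ count P? a) (count-none (P? ∩? (a ≤?_)) (λ i<a (_ , a≤i) → <⇒≱ i<a a≤i))
... | inj₁ a<1+n = begin
  count (P? ∩? (a ≤?_)) n + indicator (P? n ×-dec a ≤? n) + count P? a
    ≡⟨ xy∙z≈xz∙y (count (P? ∩? (a ≤?_)) n) _ _ ⟩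
  count (P? ∩? (a ≤?_)) n + count P? a + indicator (P? n ×-dec a ≤? n)
    ≡⟨ cong₂ _+_ (count-≥ P? (s≤s⁻¹ a<1+n)) (indicator-⇔ (mk⇔ proj₁ (_, s≤s⁻¹ a<1+n)) (P? n ×-dec a ≤? n) (P? n)) ⟩
  count P? n + indicator (P? n) ∎
  where open ≡-Reasoning

count-≟ : ∀ {t n} → t < n → count (_≟ t) n ≡ 1
count-≟ {t} {suc n} t<1+n with n ≟ t
... | yes refl = cong₂ _+_ (count-none (_≟ t) (λ i<t i≡t → <⇒≢ i<t i≡t)) (indicator-yes (t ≟ t) refl)
... | no n≢t   = cong₂ _+_ (count-≟ (≤∧≢⇒< (s≤s⁻¹ t<1+n) (n≢t ∘ sym))) (indicator-no (n ≟ t) n≢t)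

count-≟≤1 : ∀ t n → count (_≟ t) n ≤ 1
count-≟≤1 t n with t <? n
... | yes t<n = ≤-reflexive (count-≟ t<n)
... | no t≮n  = ≤-trans (count-monoʳ (_≟ t) (≤-trans (≮⇒≥ t≮n) (n≤1+n t))) (≤-reflexive (count-≟ {t} ≤-refl))

module _ (Q? : Decidable Q) where

  count-insert : ∀ {t n} → t < n → ¬ Q t → count ((_≟ t) ∪? Q?) n ≡ suc (count Q? n)
  count-insert {t} {n} t<n ¬Qt = begin
    count ((_≟ t) ∪? Q?) n       ≡⟨ count-disjoint (_≟ t) Q? n (λ { _ refl → ¬Qt }) ⟩
    count (_≟ t) n + count Q? n  ≡⟨ cong (_+ count Q? n) (count-≟ t<n) ⟩
    suc (count Q? n)             ∎
    where open ≡-Reasoning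

  count-insert-≤ : ∀ t n → count ((_≟ t) ∪? Q?) n ≤ suc (count Q? n)
  count-insert-≤ t n = ≤-trans (count-∪≤ (_≟ t) Q? n) (+-monoˡ-≤ (count Q? n) (count-≟≤1 t n))

intermediateValue : (f : ℕ → ℕ) → (∀ t → f (suc t) ≤ suc (f t)) →
  ∀ {r} b → f 0 ≤ r → r ≤ f b → ∃[ t ] t ≤ b × f t ≡ r
intermediateValue f step zero    f0≤r r≤f0 = 0 , z≤n , ≤-antisym f0≤r r≤f0
intermediateValue f step {r} (suc b) f0≤r r≤f[1+b] with r ≟ f (suc b)
... | yes r≡f[1+b] = suc b , ≤-refl , sym r≡f[1+b]
... | no r≢f[1+b] with intermediateValue f step b f0≤r (s≤s⁻¹ (≤-trans (≤∧≢⇒< r≤f[1+b] r≢f[1+b]) (step b)))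
...   | t , t≤b , ft≡r = t , m≤n⇒m≤1+n t≤b , ft≡r

_Tags_ : ℕ → ℕ → Set
w Tags n = w ∣ n × (w ≡ 1 → n ≡ 1)

coprime⇒¬sharedTag : ∀ {n m w} → n ≢ m → Coprime n m → w Tags n → w Tags m → ⊥
coprime⇒¬sharedTag n≢m coprime (w∣n , n≡1) (w∣m , m≡1) = n≢m (trans (n≡1 w≡1) (sym (m≡1 w≡1)))
  where w≡1 = coprime (w∣n , w∣m)

length≤count-of-tags : (P? : Decidable P) → ∀ {N S} → AllPairs _≢_ S → AllPairs Coprime S →
  All (λ n → ∃[ w ] w < N × P w × w Tags n) S → length S ≤ count P? N
length≤count-of-tags P? [] [] [] = z≤n
length≤count-of-tags {P = P} P? {N} {n ∷ S} (n≢S ∷ distinct) (n⊥S ∷ coprime) ((w , w<N , Pw , wTn) ∷ tags) = begin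
  suc (length S)           ≤⟨ s≤s (length≤count-of-tags P′? distinct coprime (All.zipWith retag (All.zip (n≢S , n⊥S) , tags))) ⟩
  suc (count P′? N)        ≡⟨ count-insert P′? w<N (λ (_ , w≢w) → w≢w refl) ⟨
  count ((_≟ w) ∪? P′?) N  ≤⟨ count-mono ((_≟ w) ∪? P′?) P? N (λ { _ (inj₁ refl) → Pw ; _ (inj₂ (Pv , _)) → Pv }) ⟩
  count P? N               ∎
  where
  open ≤-Reasoning
  P′? = P? ∩? ∁? (_≟ w)
  retag : ∀ {m} → (n ≢ m × Coprime n m) × (∃[ v ] v < N × P v × v Tags m) → ∃[ v ] v < N × (P ∩ ∁ (_≡ w)) v × v Tags m
  retag ((n≢m , n⊥m) , (v , v<N , Pv , vTm)) = v , v<N , (Pv , λ { refl → coprime⇒¬sharedTag n≢m n⊥m wTn vTm }) , vTm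

¬monoCoprimeSet : ∀ {c x k b N} (P? : Decidable P) →
  (∀ {n} → 1 ≤ n → n ≤ x → c n ≡ b → ∃[ w ] w < N × P w × w Tags n) →
  count P? N < k → ¬ MonoCoprimeSet c x k b
¬monoCoprimeSet P? tag count<k (S , refl , distinct , coprime , inRange , coloured) =
  <⇒≱ count<k (length≤count-of-tags P? distinct coprime
    (All.zipWith (λ ((1≤n , n≤x) , cn≡b) → tag 1≤n n≤x cn≡b) (inRange , coloured)))

OddPrime : Pred ℕ 0ℓ
OddPrime = Prime ∩ (3 ≤_)

oddPrime? : Decidable OddPrime
oddPrime? = prime? ∩? (3 ≤?_)

prime∣prime⇒≡ : ∀ {q p} → Prime q → Prime p → q ∣ p → q ≡ p
prime∣prime⇒≡ q-prime p-prime q∣p with prime⇒irreducible p-prime q∣p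
... | inj₁ refl = contradiction q-prime ¬prime[1]
... | inj₂ q≡p  = q≡p

prime≢2⇒3≤ : ∀ {q} → Prime q → q ≢ 2 → 3 ≤ q
prime≢2⇒3≤ {0}                 q-prime _   = contradiction q-prime ¬prime[0]
prime≢2⇒3≤ {1}                 q-prime _   = contradiction q-prime ¬prime[1]
prime≢2⇒3≤ {2}                 _       q≢2 = contradiction refl q≢2
prime≢2⇒3≤ {suc (suc (suc q))} _       _   = s≤s (s≤s (s≤s z≤n))

∃primeFactor : ∀ {n} → 2 ≤ n → ∃[ q ] Prime q × q ∣ n
∃primeFactor {n@(suc _)} 2≤n with factorise n
... | record { factors = [] ; isFactorisation = n≡1 } = contradiction n≡1 (>⇒≢ 2≤n)
... | record { factors = q ∷ qs ; isFactorisation = n≡q*Πqs ; factorsPrime = q-prime ∷ _ } =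
  q , q-prime , subst (q ∣_) (sym n≡q*Πqs) (m∣m*n (product qs))

even⊎odd : ∀ n → ∃[ m ] (n ≡ 2 * m ⊎ n ≡ suc (2 * m))
even⊎odd zero    = 0 , inj₁ refl
even⊎odd (suc n) with even⊎odd n
... | m , inj₁ n≡2m   = m , inj₂ (cong suc n≡2m)
... | m , inj₂ n≡1+2m = suc m , inj₁ (trans (cong suc n≡1+2m) (sym (*-suc 2 m)))

prime≢2⇒odd : ∀ {p} → Prime p → p ≢ 2 → ∃[ m ] p ≡ suc (2 * m)
prime≢2⇒odd {p} p-prime p≢2 with even⊎odd p
... | m , inj₂ p≡1+2m = m , p≡1+2m
... | m , inj₁ p≡2m   = contradiction (sym (prime∣prime⇒≡ prime[2] p-prime (divides m (trans p≡2m (*-comm 2 m))))) p≢2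

count-evens : ∀ m → count (λ i → 2 ∣? suc i) (2 * m) ≡ m
count-evens zero    = refl
count-evens (suc m) = begin
  count even? (2 * suc m)
    ≡⟨ cong (count even?) (*-suc 2 m) ⟩
  count even? (2 * m) + indicator (2 ∣? suc (2 * m)) + indicator (2 ∣? 2 + 2 * m)
    ≡⟨ cong₂ _+_ (cong₂ _+_ (count-evens m) (indicator-no (2 ∣? suc (2 * m)) 2∤1+2m))
                 (indicator-yes (2 ∣? 2 + 2 * m) 2∣2+2m) ⟩
  m + 0 + 1
    ≡⟨ trans (cong (_+ 1) (+-identityʳ m)) (+-comm m 1) ⟩
  suc m ∎
  where
  open ≡-Reasoning
  even? = λ i → 2 ∣? suc i
  2∤1+2m : ¬ 2 ∣ suc (2 * m)
  2∤1+2m (divides q 1+2m≡q*2) = even≢odd q m (trans (*-comm 2 q) (sym 1+2m≡q*2))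
  2∣2+2m : 2 ∣ 2 + 2 * m
  2∣2+2m = subst (2 ∣_) (*-suc 2 m) (m∣m*n (suc m))

multiplesOfAny : List ℕ → ℕ → ℕ
multiplesOfAny L = count (λ i → any? (_∣? suc i) L)

multiplesOfAny-periodic : ∀ {d} L → All (_∣ d) L → ∀ n → multiplesOfAny L (n + d) ≡ multiplesOfAny L n + multiplesOfAny L d
multiplesOfAny-periodic {d} L L∣d = count-periodic (λ i → any? (_∣? suc i) L) d (λ _ → shift L∣d)
  where
  shift : ∀ {n L} → All (_∣ d) L → Any (_∣ n + d) L ⇔ Any (_∣ n) L
  shift []                           = mk⇔ (λ ()) (λ ())
  shift {n} (_∷_ {x = q} q∣d L∣d) = mk⇔
    (λ { (here q∣n+d) → here (∣m+n∣m⇒∣n (subst (q ∣_) (+-comm n d) q∣n+d) q∣d)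
       ; (there any)    → there (Equivalence.to (shift L∣d) any) })
    (λ { (here q∣n)     → here (∣m∣n⇒∣m+n q∣n q∣d)
       ; (there any)    → there (Equivalence.from (shift L∣d) any) })

half≤1+multiplesOf[3] : ∀ {m} → m < 4 → m ≤ suc (multiplesOfAny (3 ∷ []) (2 * m))
half≤1+multiplesOf[3] = from-yes (allUpTo? (λ m → m ≤? suc (multiplesOfAny (3 ∷ []) (2 * m))) 4)

half≤1+multiplesOf[3,5] : ∀ {m} → m < 7 → m ≤ suc (multiplesOfAny (3 ∷ 5 ∷ []) (2 * m))
half≤1+multiplesOf[3,5] = from-yes (allUpTo? (λ m → m ≤? suc (multiplesOfAny (3 ∷ 5 ∷ []) (2 * m))) 7)

-- 114 of the numbers in [1, 210] are multiples of 3, 5 or 7, and 210 = 2 · 3 · 5 · 7.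
half≤1+multiplesOf[3,5,7] : ∀ m → m ≤ suc (multiplesOfAny (3 ∷ 5 ∷ 7 ∷ []) (2 * m))
half≤1+multiplesOf[3,5,7] m = *-cancelˡ-≤ 2 (subst (λ x → x ≤ 2 * suc (M x)) (sym (m≡m%n+[m/n]*n (2 * m) 210))
  (periods ((2 * m) / 210) (m%n<n (2 * m) 210)))
  where
  M = multiplesOfAny (3 ∷ 5 ∷ 7 ∷ [])
  first-period : ∀ {r} → r < 210 → r ≤ 2 * suc (M r)
  first-period = from-yes (allUpTo? (λ r → r ≤? 2 * suc (M r)) 210)
  periods : ∀ q {r} → r < 210 → r + q * 210 ≤ 2 * suc (M (r + q * 210))
  periods zero    {r} r<210 = subst (λ x → x ≤ 2 * suc (M x)) (sym (+-identityʳ r)) (first-period r<210)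
  periods (suc q) {r} r<210 = subst (λ x → x ≤ 2 * suc (M x)) (sym (x∙yz≈xz∙y r 210 (q * 210))) (begin
    y + 210                  ≤⟨ +-mono-≤ (periods q r<210) (m≤m+n 210 18) ⟩
    2 * suc (M y) + 2 * 114  ≡⟨ *-distribˡ-+ 2 (suc (M y)) 114 ⟨
    2 * suc (M y + M 210)    ≡⟨ cong (λ l → 2 * suc l) (multiplesOfAny-periodic (3 ∷ 5 ∷ 7 ∷ []) 210-multiple y) ⟨
    2 * suc (M (y + 210))    ∎)
    where
    open ≤-Reasoning
    y = r + q * 210
    210-multiple : All (_∣ 210) (3 ∷ 5 ∷ 7 ∷ [])
    210-multiple = divides 70 refl ∷ divides 42 refl ∷ divides 30 refl ∷ []

countColour0≡count : ∀ c x → countColour0 c x ≡ count (λ i → c (suc i) Bool.≟ false) x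
countColour0≡count c x = begin
  length (filter colour0? (map suc (upTo x)))  ≡⟨ cong (length ∘ filter colour0?) (map-upTo suc x) ⟩
  length (filter colour0? (applyUpTo suc x))   ≡⟨ length-filter-applyUpTo colour0? suc x ⟩
  count (colour0? ∘ suc) x                     ∎
  where
  open ≡-Reasoning
  colour0? = λ i → c i Bool.≟ false

countColour0-does : (P? : Decidable P) → ∀ x → countColour0 (does ∘ P?) x ≡ count (∁? P? ∘ suc) x
countColour0-does P? x =
  trans (countColour0≡count (does ∘ P?) x) (count-cong _ (∁? P? ∘ suc) x (λ {i} _ → does≡false⇔¬ (P? (suc i))))
  where
  does≡false⇔¬ : (A? : Dec A) → (does A? ≡ false) ⇔ (¬ A)
  does≡false⇔¬ (yes a)  = mk⇔ (λ ()) (λ ¬a → contradiction a ¬a)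
  does≡false⇔¬ (no ¬a) = mk⇔ (λ _ → ¬a) (λ _ → refl)

countColour0-not : ∀ c x → countColour0 (not ∘ c) x + countColour0 c x ≡ x
countColour0-not c x = begin
  countColour0 (not ∘ c) x + countColour0 c x
    ≡⟨ cong₂ _+_ (countColour0≡count (not ∘ c) x) (countColour0≡count c x) ⟩
  count (λ i → not (c (suc i)) Bool.≟ false) x + count colour0? x
    ≡⟨ cong (_+ count colour0? x) (count-cong _ (∁? colour0?) x (λ {i} _ → not≡false⇔ (c (suc i)))) ⟩
  count (∁? colour0?) x + count colour0? x
    ≡⟨ +-comm (count (∁? colour0?) x) _ ⟩
  count colour0? x + count (∁? colour0?) x
    ≡⟨ count-∁ colour0? x ⟩
  x ∎
  where
  open ≡-Reasoning
  colour0? = λ i → c (suc i) Bool.≟ false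
  not≡false⇔ : ∀ b → (not b ≡ false) ⇔ (¬ b ≡ false)
  not≡false⇔ false = mk⇔ (λ ()) (λ ¬b≡false → contradiction refl ¬b≡false)
  not≡false⇔ true  = mk⇔ (λ _ ()) (λ _ → refl)

monoCoprimeSet-not : ∀ {c x k b} → MonoCoprimeSet (not ∘ c) x k b → MonoCoprimeSet c x k (not b)
monoCoprimeSet-not (S , length≡k , distinct , coprime , inRange , coloured) =
  S , length≡k , distinct , coprime , inRange , All.map (λ not[cn]≡b → trans (sym (not-involutive _)) (cong not not[cn]≡b)) coloured

CoprimeFreeColouring : ℕ → ℕ → ℕ → Set
CoprimeFreeColouring x k r = Σ (ℕ → Bool) λ c → countColour0 c x ≡ r × ((b : Bool) → ¬ MonoCoprimeSet c x k b)

coprimeFreeColouring-not : ∀ {x k r} → CoprimeFreeColouring x k r → CoprimeFreeColouring x k (x ∸ r)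
coprimeFreeColouring-not {x} (c , refl , ¬mono) =
  not ∘ c ,
  trans (sym (m+n∸n≡m _ (countColour0 c x))) (cong (_∸ countColour0 c x) (countColour0-not c x)) ,
  λ b → ¬mono (not b) ∘ monoCoprimeSet-not

reflect-about-half : ∀ {m r d} → r ≤ m → m ≤ r + d → m ≤ 2 * m ∸ r × 2 * m ∸ r ≤ m + d
reflect-about-half {m} {r} {d} r≤m m≤r+d = m≤2m∸r , m≤n+o⇒m∸n≤o (2 * m) r 2m≤r+[m+d]
  where
  open ≤-Reasoning
  2m≡m+m : 2 * m ≡ m + m
  2m≡m+m = cong (m +_) (+-identityʳ m)
  m≤2m∸r = begin
    m          ≡⟨ m+n∸m≡n m m ⟨
    m + m ∸ m  ≡⟨ cong (_∸ m) 2m≡m+m ⟨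
    2 * m ∸ m  ≤⟨ ∸-monoʳ-≤ (2 * m) r≤m ⟩
    2 * m ∸ r  ∎
  2m≤r+[m+d] = begin
    2 * m        ≡⟨ 2m≡m+m ⟩
    m + m        ≤⟨ +-monoˡ-≤ m m≤r+d ⟩
    r + d + m    ≡⟨ xy∙z≈x∙zy r d m ⟩
    r + (m + d)  ∎

module ThresholdColouring (T : ℕ) (3≤T : 3 ≤ T) where

  SmallOddPrimeFactor : Pred ℕ 0ℓ
  SmallOddPrimeFactor n = ∃[ q ] q < T × OddPrime q × q ∣ n

  Class₁ : ℕ → Pred ℕ 0ℓ
  Class₁ t n = (n ≡ 1 ⊎ SmallOddPrimeFactor n) × ¬ (2 ∣ n × n ≤ t)

  class₁? : ∀ t → Decidable (Class₁ t)
  class₁? t n = (n ≟ 1 ⊎-dec anyUpTo? (λ q → oddPrime? q ×-dec q ∣? n) T) ×-dec ¬? (2 ∣? n ×-dec n ≤? t)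

  colouring : ℕ → ℕ → Bool
  colouring t = does ∘ class₁? t

  class₀Count : ℕ → ℕ → ℕ
  class₀Count t = count (∁? (class₁? t) ∘ suc)

  largePrime? : Decidable (Prime ∩ (T ≤_))
  largePrime? = prime? ∩? (T ≤?_)

  class₁-tag : ∀ {t n} → Class₁ t n → ∃[ w ] w < T × ((_≡ 1) ∪ OddPrime) w × w Tags n
  class₁-tag (inj₁ refl , _) = 1 , ≤-trans (s≤s (s≤s z≤n)) 3≤T , inj₁ refl , ∣-refl , λ _ → refl
  class₁-tag (inj₂ (q , q<T , q-oddPrime@(q-prime , _) , q∣n) , _) =
    q , q<T , inj₂ q-oddPrime , q∣n , λ { refl → contradiction q-prime ¬prime[1] }

  class₀-tag : ∀ {t n} → 1 ≤ n → ¬ Class₁ t n → ∃[ w ] ((_≡ 2) ∪ Prime ∩ (T ≤_)) w × w Tags n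
  class₀-tag {t} {n} 1≤n ¬class₁ with 2 ∣? n | n ≟ 1
  ... | yes 2∣n | _        = 2 , inj₁ refl , 2∣n , λ ()
  ... | no 2∤n  | yes refl = contradiction (inj₁ refl , 2∤n ∘ proj₁) ¬class₁
  ... | no 2∤n  | no n≢1   with ∃primeFactor (≤∧≢⇒< 1≤n (n≢1 ∘ sym))
  ...   | q , q-prime , q∣n with T ≤? q
  ...     | yes T≤q = q , inj₂ (q-prime , T≤q) , q∣n , λ { refl → contradiction q-prime ¬prime[1] }
  ...     | no T≰q  = contradiction (inj₂ (q , ≰⇒> T≰q , (q-prime , 3≤q) , q∣n) , 2∤n ∘ proj₁) ¬class₁
    where 3≤q = prime≢2⇒3≤ q-prime (λ { refl → 2∤n q∣n })

  count-oneOrOddPrime≤ : count ((_≟ 1) ∪? oddPrime?) T ≤ count prime? T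
  count-oneOrOddPrime≤ = begin
    count ((_≟ 1) ∪? oddPrime?) T        ≤⟨ count-insert-≤ oddPrime? 1 T ⟩
    suc (count oddPrime? T)              ≡⟨ +-comm 1 _ ⟩
    count oddPrime? T + count prime? 3   ≡⟨ count-≥ prime? 3≤T ⟩
    count prime? T                       ∎
    where open ≤-Reasoning

  count-largePrime : ∀ {N a b} → T ≤ N → count prime? T ≡ a → count prime? N ≡ a + b → count largePrime? N ≡ b
  count-largePrime {N} {a} {b} T≤N π[T] π[N] = +-cancelʳ-≡ _ _ _ (begin
    count largePrime? N + a               ≡⟨ cong (_ +_) π[T] ⟨
    count largePrime? N + count prime? T  ≡⟨ count-≥ prime? T≤N ⟩
    count prime? N                        ≡⟨ π[N] ⟩
    a + b                                 ≡⟨ +-comm a b ⟩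
    b + a                                 ∎)
    where open ≡-Reasoning

  colouring-¬mono : ∀ {x k} t b → count prime? T < k → suc (count largePrime? (suc x)) < k →
    ¬ MonoCoprimeSet (colouring t) x k b
  colouring-¬mono t true  π[T]<k _ =
    ¬monoCoprimeSet ((_≟ 1) ∪? oddPrime?) (λ _ _ → class₁-tag ∘ does≡true⇒ (class₁? t _))
      (≤-<-trans count-oneOrOddPrime≤ π[T]<k)
  colouring-¬mono {x} t false _ 1+large<k =
    ¬monoCoprimeSet ((_≟ 2) ∪? largePrime?) tag (≤-<-trans (count-insert-≤ largePrime? 2 (suc x)) 1+large<k)
    where
    tag : ∀ {n} → 1 ≤ n → n ≤ x → colouring t n ≡ false → ∃[ w ] w < suc x × ((_≡ 2) ∪ Prime ∩ (T ≤_)) w × w Tags n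
    tag 1≤n n≤x colour0 with class₀-tag 1≤n (does≡false⇒¬ (class₁? t _) colour0)
    ... | w , w-tag , w∣n , n≡1 = w , s≤s (≤-trans (∣⇒≤ {{>-nonZero 1≤n}} w∣n) n≤x) , w-tag , w∣n , n≡1

  class₀Count-step : ∀ t x → class₀Count (suc t) x ≤ suc (class₀Count t x)
  class₀Count-step t x = begin
    class₀Count (suc t) x                     ≤⟨ count-mono _ ((_≟ t) ∪? ∁? (class₁? t) ∘ suc) x recoloured ⟩
    count ((_≟ t) ∪? ∁? (class₁? t) ∘ suc) x  ≤⟨ count-insert-≤ (∁? (class₁? t) ∘ suc) t x ⟩
    suc (class₀Count t x)                     ∎
    where
    open ≤-Reasoning
    recoloured : ∀ {i} → i < x → ¬ Class₁ (suc t) (suc i) → i ≡ t ⊎ ¬ Class₁ t (suc i)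
    recoloured {i} _ ¬class₁ with i ≟ t
    ... | yes i≡t = inj₁ i≡t
    ... | no i≢t  = inj₂ λ (c , ¬even≤t) →
      ¬class₁ (c , λ (2∣1+i , 1+i≤1+t) → ¬even≤t (2∣1+i , ≤∧≢⇒< (s≤s⁻¹ 1+i≤1+t) i≢t))

  class₀Count[0]≤ : ∀ {L} m → All OddPrime L → All (_< T) L →
    m ≤ suc (multiplesOfAny L (2 * m)) → class₀Count 0 (2 * m) ≤ m
  class₀Count[0]≤ zero _ _ _ = z≤n
  class₀Count[0]≤ {L} m@(suc _) L-odd L<T m≤1+M = +-cancelʳ-≤ m _ m (begin
    c₀ + m
      ≤⟨ +-monoʳ-≤ c₀ m≤1+M ⟩
    c₀ + suc (multiplesOfAny L (2 * m))
      ≡⟨ cong (c₀ +_) (count-insert multiple? (≤-trans z<s (m≤m+n m _)) ¬multiple[1]) ⟨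
    c₀ + count covered? (2 * m)
      ≤⟨ +-monoˡ-≤ _ (count-mono _ (∁? covered?) (2 * m) (λ _ ¬class₁ → ¬class₁ ∘ covered⇒class₁)) ⟩
    count (∁? covered?) (2 * m) + count covered? (2 * m)
      ≡⟨ +-comm (count (∁? covered?) (2 * m)) _ ⟩
    count covered? (2 * m) + count (∁? covered?) (2 * m)
      ≡⟨ count-∁ covered? (2 * m) ⟩
    2 * m
      ≡⟨ cong (m +_) (+-identityʳ m) ⟩
    m + m ∎)
    where
    open ≤-Reasoning
    c₀ = class₀Count 0 (2 * m)
    multiple? = λ i → any? (_∣? suc i) L
    covered? = (_≟ 0) ∪? multiple?
    ¬multiple[1] : ¬ Any (_∣ 1) L
    ¬multiple[1] q∣1 with All.lookupAny L-odd q∣1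
    ... | (_ , 3≤q) , q∣1 = contradiction (subst (3 ≤_) (∣1⇒≡1 q∣1) 3≤q) λ { (s≤s ()) }
    covered⇒class₁ : ∀ {i} → i ≡ 0 ⊎ Any (_∣ suc i) L → Class₁ 0 (suc i)
    covered⇒class₁ (inj₁ refl) = inj₁ refl , λ ()
    covered⇒class₁ (inj₂ q∣1+i) with All.lookupAny (All.zip (L-odd , L<T)) q∣1+i
    ... | (q-oddPrime , q<T) , q∣1+i = inj₂ (_ , q<T , q-oddPrime , q∣1+i) , λ ()

  class₀Count[x]≥ : ∀ m → m + count largePrime? (suc (2 * m)) ≤ class₀Count (2 * m) (2 * m)
  class₀Count[x]≥ m = begin
    m + count largePrime? (suc (2 * m))
      ≡⟨ cong₂ _+_ (count-evens m) (count-∘suc largePrime? (¬prime[0] ∘ proj₁) (2 * m)) ⟨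
    count even? (2 * m) + count (largePrime? ∘ suc) (2 * m)
      ≡⟨ count-disjoint even? (largePrime? ∘ suc) (2 * m) ¬even∧largePrime ⟨
    count (even? ∪? largePrime? ∘ suc) (2 * m)
      ≤⟨ count-mono _ (∁? (class₁? (2 * m)) ∘ suc) (2 * m) class₀ ⟩
    class₀Count (2 * m) (2 * m) ∎
    where
    open ≤-Reasoning
    even? = λ i → 2 ∣? suc i
    ¬even∧largePrime : ∀ {i} → i < 2 * m → 2 ∣ suc i → (Prime ∩ (T ≤_)) (suc i) → ⊥
    ¬even∧largePrime _ 2∣1+i (1+i-prime , T≤1+i) =
      <⇒≱ 3≤T (subst (T ≤_) (sym (prime∣prime⇒≡ prime[2] 1+i-prime 2∣1+i)) T≤1+i)
    class₀ : ∀ {i} → i < 2 * m → 2 ∣ suc i ⊎ (Prime ∩ (T ≤_)) (suc i) → ¬ Class₁ (2 * m) (suc i)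
    class₀ i<2m (inj₁ 2∣1+i) (_ , ¬even≤2m) = ¬even≤2m (2∣1+i , i<2m)
    class₀ _ (inj₂ (1-prime , _)) (inj₁ refl , _) = ¬prime[1] 1-prime
    class₀ _ (inj₂ (1+i-prime , T≤1+i)) (inj₂ (q , q<T , (q-prime , _) , q∣1+i) , _) =
      <⇒≱ q<T (subst (T ≤_) (sym (prime∣prime⇒≡ q-prime 1+i-prime q∣1+i)) T≤1+i)

  below-T : ∀ {q k} → count prime? T ≡ k → count prime? q < k → q < T
  below-T π[T] π[q]<k = count-cancelʳ-< prime? (subst (_ <_) (sym π[T]) π[q]<k)

  below-half : ∀ {m k n} → count prime? (suc (2 * m)) ≡ k → k < count prime? (2 * n) → m < n
  below-half {m} {k} {n} π[1+2m] k<π[2n] =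
    *-cancelˡ-< 2 m n (<-trans (n<1+n (2 * m)) (count-cancelʳ-< prime? (subst (_< _) (sym π[1+2m]) k<π[2n])))

  -- For j ≤ 1 the primes 3, 5, 7 are not all below T, but then 2m ≤ 12 and a finite check suffices.
  class₀Count[0]≤half : ∀ j m → count prime? T ≡ suc (suc j) → count prime? (suc (2 * m)) ≡ suc (suc j) + suc j →
    class₀Count 0 (2 * m) ≤ m
  class₀Count[0]≤half 0 m π[T] π[1+2m] =
    class₀Count[0]≤ m (from-yes (all? oddPrime? (3 ∷ []))) (3<T ∷ [])
      (half≤1+multiplesOf[3] (below-half π[1+2m] (n<1+n 3)))
    where 3<T = below-T π[T] (n<1+n 1)
  class₀Count[0]≤half 1 m π[T] π[1+2m] =
    class₀Count[0]≤ m (from-yes (all? oddPrime? (3 ∷ 5 ∷ []))) (<-trans (from-yes (3 <? 5)) 5<T ∷ 5<T ∷ [])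
      (half≤1+multiplesOf[3,5] (below-half π[1+2m] (n<1+n 5)))
    where 5<T = below-T π[T] (n<1+n 2)
  class₀Count[0]≤half (suc (suc j)) m π[T] _ =
    class₀Count[0]≤ m (from-yes (all? oddPrime? (3 ∷ 5 ∷ 7 ∷ [])))
      (<-trans (from-yes (3 <? 7)) 7<T ∷ <-trans (from-yes (5 <? 7)) 7<T ∷ 7<T ∷ [])
      (half≤1+multiplesOf[3,5,7] m)
    where 7<T = below-T π[T] (s≤s (s≤s (s≤s (s≤s z≤n))))

  coprimeFreeColouring-≥half : ∀ j m → T ≤ suc (2 * m) → count prime? T ≡ suc (suc j) →
    count prime? (suc (2 * m)) ≡ suc (suc j) + suc j →
    ∀ {r} → m ≤ r → r ≤ m + suc j → CoprimeFreeColouring (2 * m) (3 + j) r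
  coprimeFreeColouring-≥half j m T≤1+2m π[T] π[1+2m] {r} m≤r r≤m+1+j =
    colouring t , trans (countColour0-does (class₁? t) (2 * m)) class₀Count≡r ,
    λ b → colouring-¬mono t b (subst (_< 3 + j) (sym π[T]) ≤-refl) (subst (λ l → suc l < 3 + j) (sym large) ≤-refl)
    where
    large = count-largePrime T≤1+2m π[T] π[1+2m]
    reached : ∃[ t ] t ≤ 2 * m × class₀Count t (2 * m) ≡ r
    reached = intermediateValue (λ t → class₀Count t (2 * m)) (λ t → class₀Count-step t (2 * m)) (2 * m)
      (≤-trans (class₀Count[0]≤half j m π[T] π[1+2m]) m≤r)
      (≤-trans r≤m+1+j (subst (λ l → m + l ≤ class₀Count (2 * m) (2 * m)) large (class₀Count[x]≥ m)))
    t = proj₁ reached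
    class₀Count≡r = proj₂ (proj₂ reached)

  coprimeFreeColouring : ∀ j m → T ≤ suc (2 * m) → count prime? T ≡ suc (suc j) →
    count prime? (suc (2 * m)) ≡ suc (suc j) + suc j →
    ∀ {r} → r ≤ m + suc j → m ≤ r + suc j → CoprimeFreeColouring (2 * m) (3 + j) r
  coprimeFreeColouring j m T≤1+2m π[T] π[1+2m] {r} r≤m+1+j m≤r+1+j with m ≤? r
  ... | yes m≤r = coprimeFreeColouring-≥half j m T≤1+2m π[T] π[1+2m] m≤r r≤m+1+j
  ... | no m≰r  = subst (CoprimeFreeColouring (2 * m) (3 + j)) (m∸[m∸n]≡n (≤-trans r≤m (m≤m+n m _)))
    (coprimeFreeColouring-not (coprimeFreeColouring-≥half j m T≤1+2m π[T] π[1+2m] m≤2m∸r 2m∸r≤m+1+j))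
    where
    r≤m = <⇒≤ (≰⇒> m≰r)
    m≤2m∸r = proj₁ (reflect-about-half r≤m m≤r+1+j)
    2m∸r≤m+1+j = proj₂ (reflect-about-half r≤m m≤r+1+j)

coprimeFreeColouring : ∀ j m → count prime? (suc (2 * m)) ≡ suc (suc j) + suc j →
  ∀ {r} → r ≤ m + suc j → m ≤ r + suc j → CoprimeFreeColouring (2 * m) (3 + j) r
coprimeFreeColouring j m π[1+2m]
  with T , T≤1+2m , π[T] ← intermediateValue (count prime?) (count-suc≤ prime?) (suc (2 * m)) z≤n
                              (subst (suc (suc j) ≤_) (sym π[1+2m]) (m≤m+n _ _))
  = ThresholdColouring.coprimeFreeColouring T 3≤T j m T≤1+2m π[T] π[1+2m]
  where 3≤T = count-cancelʳ-< prime? {2} (subst (0 <_) (sym π[T]) z<s)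

count-primes-nthPrime : ∀ j {p} → IsNthPrime (2 * (3 + j) ∸ 2) p → count prime? p ≡ suc (suc j) + suc j
count-primes-nthPrime j {p} (_ , 1+π[p]≡2k-2) =
  trans (sym (length-filter-applyUpTo prime? id p)) (suc-injective (trans 1+π[p]≡2k-2 (cong suc 2k-3≡)))
  where
  2k-3≡ : j + suc (suc (suc (j + 0))) ≡ suc (suc j) + suc j
  2k-3≡ = trans (+-suc j _) (cong suc (trans (+-suc j _) (cong (λ i → suc (j + suc i)) (+-identityʳ j))))

primeCount⇒1+j≤m : ∀ {j m} → count prime? (suc (2 * m)) ≡ suc (suc j) + suc j → suc j ≤ m
primeCount⇒1+j≤m {j} {m} π[1+2m] = *-cancelˡ-≤ 2 (subst (_≤ 2 * m) (cong (suc j +_) (sym (+-identityʳ (suc j))))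
  (s≤s⁻¹ (subst (_≤ suc (2 * m)) π[1+2m] (count≤ prime? (suc (2 * m))))))

-- Imported only now: the prefix operator +_ of ℤ would make the sections (n +_) above ambiguous.
open import Data.Integer using (ℤ; +_; -[1+_]; ∣_∣; _-_; _⊖_) renaming (_*_ to _*ℤ_)
import Data.Integer.Properties as ℤ

⊖-bounds : ∀ a b {d} → ∣ a ⊖ b ∣ ≤ d → a ≤ b + d × b ≤ a + d
⊖-bounds a b ∣a⊖b∣≤d with ≤-total a b
... | inj₁ a≤b = ≤-trans a≤b (m≤m+n b _) ,
                 ≤-trans (m≤n+m∸n b a) (+-monoʳ-≤ a (subst (_≤ _) (ℤ.∣⊖∣-≤ a≤b) ∣a⊖b∣≤d))
... | inj₂ b≤a = ≤-trans (m≤n+m∸n a b) (+-monoʳ-≤ b (subst (_≤ _) ∣a⊖b∣≡a∸b ∣a⊖b∣≤d)) , ≤-trans b≤a (m≤m+n a _)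
  where ∣a⊖b∣≡a∸b = trans (ℤ.∣m⊖n∣≡∣n⊖m∣ a b) (ℤ.∣⊖∣-≤ b≤a)

∣2r-2m∣≤2d⇒ : ∀ {m d} → d ≤ m → ∀ r → ∣ (+ 2) *ℤ r - + (2 * m) ∣ ≤ 2 * d →
  ∃[ n ] r ≡ + n × n ≤ m + d × m ≤ n + d
∣2r-2m∣≤2d⇒ {m} {d} _ (+ n) bound = n , refl , halve (proj₁ 2n,2m-bounds) , halve (proj₂ 2n,2m-bounds)
  where
  2n,2m-bounds = ⊖-bounds (2 * n) (2 * m)
    (subst (_≤ 2 * d) (cong ∣_∣ (trans (cong (_- + (2 * m)) (sym (ℤ.pos-* 2 n))) (ℤ.[+m]-[+n]≡m⊖n (2 * n) (2 * m)))) bound)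
  halve : ∀ {a b} → 2 * a ≤ 2 * b + 2 * d → a ≤ b + d
  halve {a} {b} le = *-cancelˡ-≤ 2 (subst (2 * a ≤_) (sym (*-distribˡ-+ 2 b d)) le)
∣2r-2m∣≤2d⇒ {m} {d} d≤m -[1+ q ] bound =
  ⊥-elim (<-irrefl refl (≤-trans (s≤s (m≤m+n (2 * m) _)) (≤-trans 1+2m+k≤2d (*-monoʳ-≤ 2 d≤m))))
  where 1+2m+k≤2d = subst (_≤ 2 * d) (cong ∣_∣ (ℤ.neg-minus-pos _ (2 * m))) bound

coprimeFreeColouring-ℤ : ∀ j m → count prime? (suc (2 * m)) ≡ suc (suc j) + suc j →
  ∀ r → ∣ (+ 2) *ℤ r - + (2 * m) ∣ ≤ 2 * suc j →
  Σ (ℕ → Bool) λ c → (+ countColour0 c (2 * m) ≡ r) × ((b : Bool) → ¬ MonoCoprimeSet c (2 * m) (3 + j) b)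
coprimeFreeColouring-ℤ j m π[1+2m] r bound
  with n , refl , n≤m+1+j , m≤n+1+j ← ∣2r-2m∣≤2d⇒ {m} (primeCount⇒1+j≤m π[1+2m]) r bound
  with c , count≡n , ¬mono ← coprimeFreeColouring j m π[1+2m] n≤m+1+j m≤n+1+j
  = c , cong +_ count≡n , ¬mono

corollary6p3 : (k : ℕ) → 3 ≤ k → (p : ℕ) → IsNthPrime (2 * k ∸ 2) p →
    (r : ℤ) → ∣ (+ 2) *ℤ r - + (p ∸ 1) ∣ ≤ 2 * (k ∸ 2) →
    Σ (ℕ → Bool) λ c →
      (+ countColour0 c (p ∸ 1) ≡ r)
      × ((b : Bool) → ¬ MonoCoprimeSet c (p ∸ 1) k b)
corollary6p3 (suc (suc (suc j))) (s≤s (s≤s (s≤s z≤n))) p p-nth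
  with m , refl ← prime≢2⇒odd (proj₁ p-nth) (λ { refl → case count-primes-nthPrime j p-nth of λ () })
  = coprimeFreeColouring-ℤ j m (count-primes-nthPrime j p-nth)
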